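{- Let $\lambda=(\lambda_1\ge\dots\ge\lambda_m\ge0)$ be a partition with $m$ parts (zero parts allowed) and $\alpha$ a composition. For $T\in\mathfrak{T}_\alpha^\lambda$ let $\tau=(\tau_1,\dots,\tau_m)$ be the shape of $Y(T)$ ($\tau_s$ = number of cells in row $s$). Then: (1) $\tau-\mathrm{Id}=(\lambda-\mathrm{Id})\cdot\sigma(T)^{ -1}$; (2) $T$ can be recovered uniquely from $Y(T)$, i.e. $Y$ is injective on $\mathfrak{T}_\alpha^\lambda$; (3) the descent set of $\sigma(T)^{ -1}$ equals $\{r:\tau_r<\tau_{r+1}-1\}$; (4) if $\tau_r<\tau_{r+1}$ then $\tau_r<\tau_{r+1}-1$; (5) $\tau$ is weakly decreasing (a partition) if and only if $\sigma(T)=\mathrm{Id}$; (6) if $\sigma(T)=\mathrm{Id}$, then $Y(T)$ is a semistandard Young tableau (partition shape, rows weakly increasing, columns strictly increasing downward) if and only if the reading word of $T$ is Yamanouchi.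
   Context: $\mathrm{Id}=(1,2,\dots,m)$; permutations of $S_m$ are identified with their one-line notation. For a vector $b=(b_1,\dots,b_m)$ and $\pi\in S_m$, $(b\cdot\pi)_i=b_{\pi(i)}$. The descent set of $\pi$ is $\{r:\pi(r)>\pi(r+1)\}$. Skew immaculate tableaux: for compositions $\alpha,\gamma$ with $\ell(\gamma)\ge\ell(\alpha)$, $\gamma_i\ge\alpha_i$ ($\alpha_i=0$ for $i>\ell(\alpha)$), a skew immaculate tableau of shape $\gamma/\alpha$ (inner shape $\alpha$) is a filling of the cells $(i,j)$, $\alpha_i<j\le\gamma_i$ (row $i$ from the top) by positive integers, rows weakly increasing left to right and column-$1$ entries strictly increasing top to bottom. Its content $c(T)$ records in position $i$ the number of entries $i$. Reading word: rows top to bottom, each right to left; Yamanouchi: each prefix contains at least as many $j$'s as $(j+1)$'s for all $j\ge1$. $\mathfrak{T}_\alpha^\lambda$ is the set of skew immaculate tableaux $T$ of inner shape $\alpha$ (any outer shape), with entries in $\{1,\dots,m\}$, such that $\sigma(T):=c(T)-\lambda+\mathrm{Id}$ is a permutation of $(1,\dots,m)$. For $T\in\mathfrak{T}_\alpha^\lambda$, $Y(T)$ is the left-justified array with rows $1,\dots,m$ (some possibly empty) where, for every cell of $T$ in row $i$ with entry $r$, a cell with entry $i$ is placed in row $\sigma(T)(r)$ of $Y(T)$, each row of $Y(T)$ then being sorted into weakly increasing order. -}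

module Defs where

open import Data.Nat using (ℕ; zero; suc; _≤_; _<_)
open import Data.Fin as Fin using (Fin; toℕ)
open import Data.Integer as ℤ using (ℤ; +_)
open import Data.List using (List; []; _∷_; length; filter; concat; concatMap; reverse; replicate; _++_; drop; take)
open import Data.List.Relation.Unary.All using (All)
open import Data.List.Relation.Unary.Linked using (Linked)
open import Data.Product using (_×_)
open import Data.Unit using (⊤)
open import Data.Empty using (⊥)
open import Relation.Binary.PropositionalEquality using (_≡_)

-- Conventions: m rows/entries; an entry r ∈ {1,…,m} is represented by
-- (r-1) : Fin m.  A tableau T is given by its list of rows (top to bottom),
-- row i listing (left to right) the entries of the cells (i,j), α_i < j ≤ γ_i.
-- Rows of T are numbered 1,2,3,… (these numbers are the entries of Y(T)).

Tab : ℕ → Set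
Tab m = List (List (Fin m))

firstColumn : ∀ {m} → Tab m → List (Fin m)
firstColumn [] = []
firstColumn ([] ∷ rs) = firstColumn rs
firstColumn ((x ∷ _) ∷ rs) = x ∷ firstColumn rs

-- T is a skew immaculate tableau of inner shape α (α a composition),
-- outer shape γ_i = α_i + length (row i), γ a composition.
IsSkewImmaculate : ∀ {m} → List ℕ → Tab m → Set
IsSkewImmaculate {m} α T =
  (length α ≤ length T)
  × All (Linked Fin._≤_) T
  × All (λ row → 0 < length row) (drop (length α) T)
  × Linked Fin._<_ (firstColumn (drop (length α) T))

count : ∀ {m} → Fin m → List (Fin m) → ℕ
count x xs = length (filter (Fin._≟ x) xs)

content : ∀ {m} → Tab m → Fin m → ℕ
content T r = count r (concat T)

-- σ(T) = c(T) − λ + Id   (Id_r = r, 1-based: index r : Fin m stands for toℕ r + 1)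
sigma : ∀ {m} → (Fin m → ℕ) → Tab m → Fin m → ℤ
sigma la T r = (+ content T r) ℤ.- (+ la r) ℤ.+ (+ suc (toℕ r))

-- helper for Y: rows of T starting with row number i; collect, for row s of Y,
-- one entry i for every cell of row i of T whose entry r has σ(r) = s.
-- Since row numbers i are processed in increasing order the resulting list
-- is already weakly increasing, i.e. it is the sorted row.
Yfrom : ∀ {m} → (Fin m → ℤ) → ℕ → Tab m → Fin m → List ℕ
Yfrom σ i [] s = []
Yfrom σ i (row ∷ rows) s =
  replicate (length (filter (λ r → σ r ℤ.≟ (+ suc (toℕ s))) row)) i ++ Yfrom σ (suc i) rows s

-- Y(T): row s (index s : Fin m stands for row toℕ s + 1) of the array
Y : ∀ {m} → (Fin m → ℕ) → Tab m → Fin m → List ℕ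
Y la T = Yfrom (sigma la T) 1 T

shapeY : ∀ {m} → (Fin m → ℕ) → Tab m → Fin m → ℕ
shapeY la T s = length (Y la T s)

Consec : ∀ {m} → Fin m → Fin m → Set
Consec i j = toℕ j ≡ suc (toℕ i)

WeaklyDecreasing : ∀ {m} → (Fin m → ℕ) → Set
WeaklyDecreasing {m} v = ∀ (i j : Fin m) → Consec i j → v j ≤ v i

-- column strictness between an upper row and the row below it
-- (also forces the lower row to be no longer than the upper one)
ColStrict : List ℕ → List ℕ → Set
ColStrict _ [] = ⊤
ColStrict [] (_ ∷ _) = ⊥
ColStrict (x ∷ xs) (y ∷ ys) = (x < y) × ColStrict xs ys

IsSSYT : ∀ {m} → (Fin m → List ℕ) → Set
IsSSYT {m} A =
  WeaklyDecreasing (λ s → length (A s))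
  × (∀ s → Linked _≤_ (A s))
  × (∀ (i j : Fin m) → Consec i j → ColStrict (A i) (A j))

readingWord : ∀ {m} → Tab m → List (Fin m)
readingWord T = concatMap reverse T

Yamanouchi : ∀ {m} → List (Fin m) → Set
Yamanouchi {m} w = ∀ (n : ℕ) (j j' : Fin m) → Consec j j' →
  count j' (take n w) ≤ count j (take n w)

-- Row s of Y(T) lists, with multiplicity, the numbers of the rows of T that contain the
-- entry r = σ⁻¹(s); so τ_s = c_r, and σ(r) = c_r − λ_r + r is (1).  Since λ − Id is
-- strictly decreasing, (1) at two rows s < s′ of Y(T) with σ⁻¹(s) > σ⁻¹(s′) gives
-- τ_{s′} ≥ τ_s + (s′ − s) + 1, and with σ⁻¹(s) < σ⁻¹(s′) gives τ_{s′} ≤ τ_s + (s′ − s) − 1;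
-- for consecutive rows this is (3), (4) and (5).  For the same reason τ determines σ, hence
-- Y(T) determines for every entry the rows of T containing it, and the sorted rows of T
-- are recovered: (2).  Finally, column strictness between rows j and j+1 of Y(T) says that
-- for every k the number of (j+1)'s in the first k rows of T is at most the number of j's in
-- the first k−1 rows.  A weakly increasing row, read right to left, lists all its j+1 before
-- its j, so this is exactly the Yamanouchi condition for the pair j, j+1.
module Submission where

open import Defs
open import Data.Nat as ℕ using (ℕ; zero; suc; _+_; _∸_; _≤_; _<_; z≤n; s≤s)
open import Data.Nat.Properties
import Data.Nat.Tactic.RingSolver as ℕSolver
open import Data.Fin as Fin using (Fin; toℕ; fromℕ; fromℕ<)
import Data.Fin.Properties as FinP
open import Data.Fin.Permutation using (Permutation′; _⟨$⟩ʳ_; _⟨$⟩ˡ_; inverseˡ; inverseʳ)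
open import Data.Integer as ℤ using (ℤ; +_)
import Data.Integer.Properties as ℤP
import Data.Integer.Tactic.RingSolver as ℤSolver
open import Data.List using (List; []; _∷_; length; filter; concat; replicate; _++_; take; drop; _ʳ++_)
open import Data.List.Properties
  using (∷-injectiveʳ; length-++; length-replicate; length-drop; ++-assoc; ʳ++-defn)
  using (filter-++; filter-accept; filter-none; filter-≐)
open import Data.List.Relation.Unary.All as All using (All; []; _∷_)
open import Data.List.Relation.Unary.All.Properties using (++⁺; replicate⁺; drop⁺)
open import Data.List.Relation.Unary.Linked as Linked using (Linked; []; [-]; _∷_)
open import Data.List.Relation.Unary.Linked.Properties using (Linked⇒All)
open import Data.Product using (_×_; _,_; proj₁; proj₂; ∃)
open import Data.Product.Function.NonDependent.Propositional using (_×-⇔_)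
open import Data.Sum using (_⊎_; inj₁; inj₂)
open import Data.Empty using (⊥-elim)
open import Data.Unit using (tt)
open import Function.Base using (_∘_)
open import Function.Bundles using (_⇔_; mk⇔; Equivalence)
open import Function.Construct.Composition using (_⇔-∘_)
open import Function.Construct.Identity using (⇔-id)
open import Function.Construct.Symmetry using (⇔-sym)
open import Relation.Binary using (Rel; Reflexive; Transitive; tri<; tri≈; tri>)
open import Relation.Binary.PropositionalEquality
open import Relation.Nullary using (yes; no)

open Equivalence using (to; from)

diff-+≡⇒+≡+ : ∀ x y z w → + x ℤ.- + y ℤ.+ + z ≡ + w → x + z ≡ w + y
diff-+≡⇒+≡+ x y z w eq = ℤP.+-injective (begin
  + (x + z)                      ≡⟨ ℤP.pos-+ x z ⟩
  + x ℤ.+ + z                    ≡⟨ regroup (+ x) (+ y) (+ z) ⟩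
  (+ x ℤ.- + y ℤ.+ + z) ℤ.+ + y  ≡⟨ cong (ℤ._+ + y) eq ⟩
  + w ℤ.+ + y                    ≡⟨ ℤP.pos-+ w y ⟨
  + (w + y)                      ∎)
  where
  open ≡-Reasoning
  regroup : ∀ a b c → a ℤ.+ c ≡ (a ℤ.- b ℤ.+ c) ℤ.+ b
  regroup = ℤSolver.solve-∀

+≡+⇒diff≡diff : ∀ x y z w → x + w ≡ z + y → + x ℤ.- + y ≡ + z ℤ.- + w
+≡+⇒diff≡diff x y z w eq = begin
  + x ℤ.- + y                      ≡⟨ regroup (+ x) (+ y) (+ w) ⟩
  (+ x ℤ.+ + w) ℤ.- (+ y ℤ.+ + w)  ≡⟨ cong₂ ℤ._-_ lifted (ℤP.+-comm (+ y) (+ w)) ⟩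
  (+ z ℤ.+ + y) ℤ.- (+ w ℤ.+ + y)  ≡⟨ regroup (+ z) (+ w) (+ y) ⟨
  + z ℤ.- + w                      ∎
  where
  open ≡-Reasoning
  regroup : ∀ a b c → a ℤ.- b ≡ (a ℤ.+ c) ℤ.- (b ℤ.+ c)
  regroup = ℤSolver.solve-∀
  lifted : + x ℤ.+ + w ≡ + z ℤ.+ + y
  lifted = trans (sym (ℤP.pos-+ x w)) (trans (cong +_ eq) (ℤP.pos-+ z y))

-- Strict decrease of λ − Id, in the form used for (2)–(5).
ascent-arith : ∀ {t t′ u u′ a b la lb} → a < b → lb ≤ la →
  t + suc a ≡ u + la → t′ + suc b ≡ u′ + lb → t′ + u < t + u′
ascent-arith {t} {t′} {u} {u′} {a} {b} {la} {lb} a<b lb≤la Ea Eb =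
  +-cancelʳ-≤ (la + b) (suc (t′ + u)) (t + u′) (begin
    suc (t′ + u) + (la + b)  ≡⟨ regroup₁ t′ u la b ⟩
    (t′ + suc b) + (u + la)  ≡⟨ cong₂ _+_ Eb (sym Ea) ⟩
    (u′ + lb) + (t + suc a)  ≤⟨ +-mono-≤ (+-monoʳ-≤ u′ lb≤la) (+-monoʳ-≤ t a<b) ⟩
    (u′ + la) + (t + b)      ≡⟨ regroup₂ u′ la t b ⟩
    (t + u′) + (la + b)      ∎)
  where
  open ≤-Reasoning
  regroup₁ : ∀ t′ u la b → suc (t′ + u) + (la + b) ≡ (t′ + suc b) + (u + la)
  regroup₁ = ℕSolver.solve-∀
  regroup₂ : ∀ u′ la t b → (u′ + la) + (t + b) ≡ (t + u′) + (la + b)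
  regroup₂ = ℕSolver.solve-∀

shifted-≤-trans : ∀ {p q r x y z} → p + y ≤ q + x → q + z ≤ r + y → p + z ≤ r + x
shifted-≤-trans {p} {q} {r} {x} {y} {z} le₁ le₂ = +-cancelʳ-≤ (q + y) (p + z) (r + x) (begin
  (p + z) + (q + y)  ≡⟨ regroup₁ p z q y ⟩
  (p + y) + (q + z)  ≤⟨ +-mono-≤ le₁ le₂ ⟩
  (q + x) + (r + y)  ≡⟨ regroup₂ q x r y ⟩
  (r + x) + (q + y)  ∎)
  where
  open ≤-Reasoning
  regroup₁ : ∀ p z q y → (p + z) + (q + y) ≡ (p + y) + (q + z)
  regroup₁ = ℕSolver.solve-∀
  regroup₂ : ∀ q x r y → (q + x) + (r + y) ≡ (r + x) + (q + y)
  regroup₂ = ℕSolver.solve-∀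

Consec⇒< : ∀ {m} {i j : Fin m} → Consec i j → i Fin.< j
Consec⇒< c = ≤-reflexive (sym c)

Consec-closure : ∀ {m ℓ} (R : Rel (Fin m) ℓ) → Reflexive R → Transitive R →
  (∀ i j → Consec i j → R i j) → ∀ {a b} → toℕ a ≤ toℕ b → R a b
Consec-closure {m} R R-refl R-trans step {a} {b} a≤b =
  subst (R a) (FinP.fromℕ<-toℕ b (FinP.toℕ<n b)) (upTo (toℕ b) (FinP.toℕ<n b) a≤b)
  where
  at : ∀ {n} (n<m : n < m) → toℕ a ≡ n → R a (fromℕ< n<m)
  at n<m a≡n = subst (R a) (FinP.toℕ-injective (trans a≡n (sym (FinP.toℕ-fromℕ< n<m)))) R-refl
  upTo : ∀ n (n<m : n < m) → toℕ a ≤ n → R a (fromℕ< n<m)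
  upTo zero    n<m a≤0 = at n<m (n≤0⇒n≡0 a≤0)
  upTo (suc n) n<m a≤n with m≤n⇒m<n∨m≡n a≤n
  ... | inj₂ a≡n       = at n<m a≡n
  ... | inj₁ (s≤s a≤k) = R-trans (upTo n n<m′ a≤k) (step _ _ consec)
    where
    n<m′ : n < m
    n<m′ = <-trans (n<1+n n) n<m
    consec : Consec (fromℕ< n<m′) (fromℕ< n<m)
    consec = trans (FinP.toℕ-fromℕ< n<m) (cong suc (sym (FinP.toℕ-fromℕ< n<m′)))

antitone : ∀ {m} {v : Fin m → ℕ} → WeaklyDecreasing v → ∀ {a b} → toℕ a ≤ toℕ b → v b ≤ v a
antitone {v = v} wd = Consec-closure (λ a b → v b ≤ v a) ≤-refl (λ p q → ≤-trans q p) wd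

la-minus-id-injective : ∀ {m} {la : Fin m → ℕ} → WeaklyDecreasing la → ∀ {t u} {a b : Fin m} →
  t + suc (toℕ a) ≡ u + la a → t + suc (toℕ b) ≡ u + la b → a ≡ b
la-minus-id-injective wd {a = a} {b} Ea Eb with FinP.<-cmp a b
... | tri≈ _ a≡b _ = a≡b
... | tri< a<b _ _ = ⊥-elim (<-irrefl refl (ascent-arith a<b (antitone wd (<⇒≤ a<b)) Ea Eb))
... | tri> _ _ b<a = ⊥-elim (<-irrefl refl (ascent-arith b<a (antitone wd (<⇒≤ b<a)) Eb Ea))

increasing⇒id : ∀ {m} (f : Fin m → Fin m) → (∀ i j → Consec i j → f i Fin.< f j) → ∀ i → f i ≡ i
increasing⇒id {suc n} f inc i = FinP.toℕ-injective (≤-antisym below above)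
  where
  Grows : Rel (Fin (suc n)) _
  Grows a b = toℕ (f a) + toℕ b ≤ toℕ (f b) + toℕ a
  grows : ∀ {a b} → toℕ a ≤ toℕ b → Grows a b
  grows = Consec-closure Grows ≤-refl grows-trans step
    where
    grows-trans : Transitive Grows
    grows-trans {a} {b} {c} =
      shifted-≤-trans {toℕ (f a)} {toℕ (f b)} {toℕ (f c)} {toℕ a} {toℕ b} {toℕ c}
    step : ∀ a b → Consec a b → Grows a b
    step a b c = subst (_≤ toℕ (f b) + toℕ a)
      (sym (trans (cong (_+_ (toℕ (f a))) c) (+-suc (toℕ (f a)) (toℕ a))))
      (+-monoˡ-≤ (toℕ a) (inc a b c))
  below : toℕ (f i) ≤ toℕ i
  below = +-cancelʳ-≤ n (toℕ (f i)) (toℕ i) (begin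
    toℕ (f i) + n             ≡⟨ cong (_+_ (toℕ (f i))) (FinP.toℕ-fromℕ n) ⟨
    toℕ (f i) + toℕ (fromℕ n) ≤⟨ grows (subst (toℕ i ≤_) (sym (FinP.toℕ-fromℕ n)) (FinP.toℕ≤pred[n] i)) ⟩
    toℕ (f (fromℕ n)) + toℕ i ≤⟨ +-monoˡ-≤ (toℕ i) (FinP.toℕ≤pred[n] (f (fromℕ n))) ⟩
    n + toℕ i                 ≡⟨ +-comm n (toℕ i) ⟩
    toℕ i + n                 ∎)
    where open ≤-Reasoning
  above : toℕ i ≤ toℕ (f i)
  above = ≤-trans (m≤n+m (toℕ i) _)
            (subst (toℕ (f Fin.zero) + toℕ i ≤_) (+-identityʳ _) (grows {Fin.zero} z≤n))

count-++ : ∀ {m} (a : Fin m) xs ys → count a (xs ++ ys) ≡ count a xs + count a ys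
count-++ a xs ys = trans (cong length (filter-++ (Fin._≟ a) xs ys)) (length-++ (filter (Fin._≟ a) xs))

count-self : ∀ {m} (a : Fin m) xs → count a (a ∷ xs) ≡ suc (count a xs)
count-self a xs = cong length (filter-accept (Fin._≟ a) refl)

count-none : ∀ {m} (a : Fin m) {xs} → All (_≢ a) xs → count a xs ≡ 0
count-none a ≢a = cong length (filter-none (Fin._≟ a) ≢a)

count-∷-+ : ∀ {m} (y x : Fin m) u c → c + count y (x ∷ u) ≡ (count y (x ∷ []) + c) + count y u
count-∷-+ y x u c with x Fin.≟ y
... | yes _ = +-suc c (count y u)
... | no _  = refl

count-∷-cancel : ∀ {m} (a x : Fin m) xs ys →
  count a (x ∷ xs) ≡ count a (x ∷ ys) → count a xs ≡ count a ys
count-∷-cancel a x xs ys eq with x Fin.≟ a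
... | yes _ = suc-injective eq
... | no _  = eq

sorted⇒head≤ : ∀ {m} {x : Fin m} {xs} → Linked Fin._≤_ (x ∷ xs) → All (x Fin.≤_) (x ∷ xs)
sorted⇒head≤ = Linked⇒All FinP.≤-trans FinP.≤-refl

count-below-head : ∀ {m} {x y : Fin m} {ys} → Linked Fin._≤_ (y ∷ ys) → x Fin.< y → count x (y ∷ ys) ≡ 0
count-below-head {x = x} sorted x<y =
  count-none x (All.map (λ { y≤z refl → <⇒≱ x<y y≤z }) (sorted⇒head≤ sorted))

sorted-≡-by-count : ∀ {m} {xs ys : List (Fin m)} → Linked Fin._≤_ xs → Linked Fin._≤_ ys →
  (∀ a → count a xs ≡ count a ys) → xs ≡ ys
sorted-≡-by-count {xs = []}     {[]}     _ _ _ = refl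
sorted-≡-by-count {xs = []}     {y ∷ ys} _ _ eq = ⊥-elim (0≢1+n (trans (eq y) (count-self y ys)))
sorted-≡-by-count {xs = x ∷ xs} {[]}     _ _ eq = ⊥-elim (0≢1+n (trans (sym (eq x)) (count-self x xs)))
sorted-≡-by-count {xs = x ∷ xs} {y ∷ ys} sx sy eq with FinP.<-cmp x y
... | tri< x<y _ _ = ⊥-elim (0≢1+n (trans (sym (trans (eq x) (count-below-head sy x<y))) (count-self x xs)))
... | tri> _ _ y<x = ⊥-elim (0≢1+n (trans (sym (trans (sym (eq y)) (count-below-head sx y<x))) (count-self y ys)))
... | tri≈ _ refl _ = cong (x ∷_)
  (sorted-≡-by-count (Linked.tail sx) (Linked.tail sy) (λ a → count-∷-cancel a x xs ys (eq a)))

rowsOf : ∀ {m} → Fin m → Tab m → ℕ → List ℕ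
rowsOf a []           i = []
rowsOf a (row ∷ rows) i = replicate (count a row) i ++ rowsOf a rows (suc i)

length-rowsOf : ∀ {m} (a : Fin m) T i → length (rowsOf a T i) ≡ content T a
length-rowsOf a []           i = refl
length-rowsOf a (row ∷ rows) i = begin
  length (replicate (count a row) i ++ rowsOf a rows (suc i))
    ≡⟨ length-++ (replicate (count a row) i) ⟩
  length (replicate (count a row) i) + length (rowsOf a rows (suc i))
    ≡⟨ cong₂ _+_ (length-replicate (count a row)) (length-rowsOf a rows (suc i)) ⟩
  count a row + count a (concat rows)
    ≡⟨ count-++ a row (concat rows) ⟨
  count a (concat (row ∷ rows)) ∎
  where open ≡-Reasoning

rowsOf-≥ : ∀ {m} (a : Fin m) T i → All (i ≤_) (rowsOf a T i)
rowsOf-≥ a []           i = []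
rowsOf-≥ a (row ∷ rows) i =
  ++⁺ (replicate⁺ (count a row) ≤-refl) (All.map (≤-trans (n≤1+n i)) (rowsOf-≥ a rows (suc i)))

replicate-++-sorted : ∀ k i {L} → All (i ≤_) L → Linked _≤_ L → Linked _≤_ (replicate k i ++ L)
replicate-++-sorted zero          i _          sorted = sorted
replicate-++-sorted (suc zero)    i []         _      = [-]
replicate-++-sorted (suc zero)    i (i≤y ∷ _)  sorted = i≤y ∷ sorted
replicate-++-sorted (suc (suc k)) i i≤L        sorted = ≤-refl ∷ replicate-++-sorted (suc k) i i≤L sorted

rowsOf-sorted : ∀ {m} (a : Fin m) T i → Linked _≤_ (rowsOf a T i)
rowsOf-sorted a []           i = []
rowsOf-sorted a (row ∷ rows) i = replicate-++-sorted (count a row) i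
  (All.map (≤-trans (n≤1+n i)) (rowsOf-≥ a rows (suc i))) (rowsOf-sorted a rows (suc i))

replicate-++-cancel : ∀ x x′ i {A A′} → All (suc i ≤_) A → All (suc i ≤_) A′ →
  replicate x i ++ A ≡ replicate x′ i ++ A′ → x ≡ x′ × A ≡ A′
replicate-++-cancel zero    zero     i _         _         eq = refl , eq
replicate-++-cancel (suc x) (suc x′) i A>i A′>i eq
  with replicate-++-cancel x x′ i A>i A′>i (∷-injectiveʳ eq)
... | x≡x′ , A≡A′ = cong suc x≡x′ , A≡A′
replicate-++-cancel zero (suc x′) i (i<a ∷ _) _ refl = ⊥-elim (1+n≰n i<a)
replicate-++-cancel (suc x) zero  i _ (i<a ∷ _) refl = ⊥-elim (1+n≰n i<a)

-- What injectivity needs from IsSkewImmaculate: only the rows inside the inner shape may be empty.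
SkewRows : ∀ {m} → ℕ → Tab m → Set
SkewRows k T = k ≤ length T × All (Linked Fin._≤_) T × All (λ row → 0 < length row) (drop k T)

IsSkewImmaculate⇒SkewRows : ∀ {m} (α : List ℕ) {T : Tab m} → IsSkewImmaculate α T → SkewRows (length α) T
IsSkewImmaculate⇒SkewRows α (k≤ , sorted , nonempty , _) = k≤ , sorted , nonempty

rowsOf-∷-nonempty : ∀ {m} (b : Fin m) r rows i → rowsOf b ((b ∷ r) ∷ rows) i ≢ []
rowsOf-∷-nonempty b r rows i rewrite count-self b r = λ ()

rowsOf≡[]⇒≡[] : ∀ {m} i (T : Tab m) → SkewRows 0 T → (∀ a → rowsOf a T i ≡ []) → T ≡ []
rowsOf≡[]⇒≡[] i []                 _                _  = refl
rowsOf≡[]⇒≡[] i ([] ∷ _)           (_ , _ , () ∷ _) _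
rowsOf≡[]⇒≡[] i ((b ∷ r) ∷ rows)   _                eq = ⊥-elim (rowsOf-∷-nonempty b r rows i (eq b))

rowsOf-injective : ∀ {m} k i (T T′ : Tab m) → SkewRows k T → SkewRows k T′ →
  (∀ a → rowsOf a T i ≡ rowsOf a T′ i) → T ≡ T′
rowsOf-injective zero    i [] T′ _        skew′ eq = sym (rowsOf≡[]⇒≡[] i T′ skew′ (λ a → sym (eq a)))
rowsOf-injective (suc k) i [] T′ (() , _) _     _
rowsOf-injective zero    i T []  skew     _     eq = rowsOf≡[]⇒≡[] i T skew eq
rowsOf-injective (suc k) i T []  _        (() , _) _
rowsOf-injective k i (row ∷ rows) (row′ ∷ rows′) skew@(_ , sorted ∷ _ , _) skew′@(_ , sorted′ ∷ _ , _) eq =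
  cong₂ _∷_
    (sorted-≡-by-count sorted sorted′ (λ a → proj₁ (split a)))
    (rowsOf-injective (ℕ.pred k) (suc i) rows rows′ (tail k skew) (tail k skew′) (λ a → proj₂ (split a)))
  where
  split : ∀ a → count a row ≡ count a row′ × rowsOf a rows (suc i) ≡ rowsOf a rows′ (suc i)
  split a = replicate-++-cancel (count a row) (count a row′) i
              (rowsOf-≥ a rows (suc i)) (rowsOf-≥ a rows′ (suc i)) (eq a)
  tail : ∀ k {r rs} → SkewRows k (r ∷ rs) → SkewRows (ℕ.pred k) rs
  tail zero    (_ , _ ∷ sorted , _ ∷ nonempty) = z≤n , sorted , nonempty
  tail (suc k) (s≤s k≤ , _ ∷ sorted , nonempty) = k≤ , sorted , nonempty

Yfrom-rowsOf : ∀ {m} {σ : Fin m → ℤ} (π : Permutation′ m) → (∀ r → σ r ≡ + suc (toℕ (π ⟨$⟩ʳ r))) →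
  ∀ i U s → Yfrom σ i U s ≡ rowsOf (π ⟨$⟩ˡ s) U i
Yfrom-rowsOf π σ≡π i []           s = refl
Yfrom-rowsOf {σ = σ} π σ≡π i (row ∷ rows) s =
  cong₂ (λ k rest → replicate k i ++ rest)
    (cong length (filter-≐ _ (Fin._≟ π ⟨$⟩ˡ s) (σ-hits-s , hits-s) row))
    (Yfrom-rowsOf π σ≡π (suc i) rows s)
  where
  σ-hits-s : ∀ {r} → σ r ≡ + suc (toℕ s) → r ≡ π ⟨$⟩ˡ s
  σ-hits-s {r} eq = trans (sym (inverseˡ π))
    (cong (π ⟨$⟩ˡ_) (FinP.toℕ-injective (suc-injective (ℤP.+-injective (trans (sym (σ≡π r)) eq)))))
  hits-s : ∀ {r} → r ≡ π ⟨$⟩ˡ s → σ r ≡ + suc (toℕ s)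
  hits-s {r} refl = trans (σ≡π r) (cong (λ q → + suc (toℕ q)) (inverseʳ π))

ColStrict-++-replicate : ∀ {i} D X y B → All (_< i) D → All (i ≤_) X →
  ColStrict (D ++ X) (replicate y i ++ B) ⇔ (y ≤ length D × ColStrict (drop y D ++ X) B)
ColStrict-++-replicate D       X       zero    B _          _         = mk⇔ (z≤n ,_) proj₂
ColStrict-++-replicate (d ∷ D) X       (suc y) B (d<i ∷ D<i) X≥i      = mk⇔
  (λ (_ , strict) → let y≤D , strict′ = to IH strict in s≤s y≤D , strict′)
  (λ { (s≤s y≤D , strict′) → d<i , from IH (y≤D , strict′) })
  where
  IH : ColStrict (D ++ X) (replicate y _ ++ B) ⇔ (y ≤ length D × ColStrict (drop y D ++ X) B)
  IH = ColStrict-++-replicate D X y B D<i X≥i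
ColStrict-++-replicate []      []      (suc y) B _          _         = mk⇔ (λ ()) (λ { (() , _) })
ColStrict-++-replicate []      (x ∷ X) (suc y) B _          (i≤x ∷ _) =
  mk⇔ (λ (x<i , _) → ⊥-elim (<⇒≱ x<i i≤x)) (λ { (() , _) })

module _ {m} (j j′ : Fin m) where

  -- c and d count the letters j′ and j read so far.
  Ballot : ℕ → ℕ → List (Fin m) → Set
  Ballot c d []      = c ≤ d
  Ballot c d (x ∷ w) = c ≤ d × Ballot (count j′ (x ∷ []) + c) (count j (x ∷ []) + d) w

  RowBallot : ℕ → ℕ → Tab m → Set
  RowBallot c d []           = c ≤ d
  RowBallot c d (row ∷ rows) = count j′ row + c ≤ d × RowBallot (count j′ row + c) (count j row + d) rows

  Ballot-head : ∀ {c d} w → Ballot c d w → c ≤ d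
  Ballot-head []      c≤d       = c≤d
  Ballot-head (_ ∷ _) (c≤d , _) = c≤d

  Ballot⇔prefixes : ∀ c d w → Ballot c d w ⇔ (∀ n → c + count j′ (take n w) ≤ d + count j (take n w))
  Ballot⇔prefixes c d [] = mk⇔
    (λ { c≤d zero → +-monoˡ-≤ 0 c≤d ; c≤d (suc n) → +-monoˡ-≤ 0 c≤d })
    (λ prefixes → +-cancelʳ-≤ 0 c d (prefixes 0))
  Ballot⇔prefixes c d (x ∷ w) = mk⇔
    (λ { (c≤d , b) zero → +-monoˡ-≤ 0 c≤d
       ; (c≤d , b) (suc n) →
           subst₂ _≤_ (sym (count-∷-+ j′ x (take n w) c)) (sym (count-∷-+ j x (take n w) d)) (to IH b n) })
    (λ prefixes → +-cancelʳ-≤ 0 c d (prefixes 0) , from IH (λ n →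
       subst₂ _≤_ (count-∷-+ j′ x (take n w) c) (count-∷-+ j x (take n w) d) (prefixes (suc n))))
    where
    IH : Ballot (count j′ (x ∷ []) + c) (count j (x ∷ []) + d) w
       ⇔ (∀ n → count j′ (x ∷ []) + c + count j′ (take n w) ≤ count j (x ∷ []) + d + count j (take n w))
    IH = Ballot⇔prefixes (count j′ (x ∷ []) + c) (count j (x ∷ []) + d) w

  -- D holds the entries of the upper list, from earlier rows, not yet matched in the lower one.
  ColStrict-rowsOf⇔RowBallot : ∀ T i D {c d} → All (_< i) D → length D + c ≡ d →
    ColStrict (D ++ rowsOf j T i) (rowsOf j′ T i) ⇔ RowBallot c d T
  ColStrict-rowsOf⇔RowBallot [] i D {c} D<i D+c≡d =
    mk⇔ (λ _ → subst (c ≤_) D+c≡d (m≤n+m c (length D))) (λ _ → tt)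
  ColStrict-rowsOf⇔RowBallot (row ∷ rows) i D {c} {d} D<i D+c≡d = mk⇔
    (λ strict → let y≤D , strict′ = to split strict in
       subst (y + c ≤_) D+c≡d (+-monoˡ-≤ c y≤D) ,
       to (IH y≤D) (subst (λ U → ColStrict U rest′) assoc strict′))
    (λ (y+c≤d , rb) → let y≤D = +-cancelʳ-≤ c y (length D) (subst (y + c ≤_) (sym D+c≡d) y+c≤d) in
       from split (y≤D , subst (λ U → ColStrict U rest′) (sym assoc) (from (IH y≤D) rb)))
    where
    x y : ℕ
    x = count j row
    y = count j′ row
    rest rest′ D′ : List ℕ
    rest  = rowsOf j rows (suc i)
    rest′ = rowsOf j′ rows (suc i)
    D′ = drop y D ++ replicate x i
    split : ColStrict (D ++ replicate x i ++ rest) (replicate y i ++ rest′)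
          ⇔ (y ≤ length D × ColStrict (drop y D ++ replicate x i ++ rest) rest′)
    split = ColStrict-++-replicate D (replicate x i ++ rest) y rest′ D<i (rowsOf-≥ j (row ∷ rows) i)
    assoc : drop y D ++ (replicate x i ++ rest) ≡ D′ ++ rest
    assoc = sym (++-assoc (drop y D) (replicate x i) rest)
    D′<1+i : All (_< suc i) D′
    D′<1+i = ++⁺ (drop⁺ y (All.map (λ d<i → ≤-trans d<i (n≤1+n i)) D<i)) (replicate⁺ x ≤-refl)
    length-D′ : y ≤ length D → length D′ + (y + c) ≡ x + d
    length-D′ y≤D = begin
      length D′ + (y + c)               ≡⟨ cong (_+ (y + c)) (trans (length-++ (drop y D))
                                             (cong₂ _+_ (length-drop y D) (length-replicate x))) ⟩
      (length D ∸ y + x) + (y + c)      ≡⟨ regroup (length D ∸ y) x y c ⟩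
      x + ((length D ∸ y + y) + c)      ≡⟨ cong (λ k → x + (k + c)) (m∸n+n≡m y≤D) ⟩
      x + (length D + c)                ≡⟨ cong (_+_ x) D+c≡d ⟩
      x + d                             ∎
      where
      open ≡-Reasoning
      regroup : ∀ k x y c → (k + x) + (y + c) ≡ x + ((k + y) + c)
      regroup = ℕSolver.solve-∀
    IH : y ≤ length D → ColStrict (D′ ++ rest) rest′ ⇔ RowBallot (y + c) (x + d) rows
    IH y≤D = ColStrict-rowsOf⇔RowBallot rows (suc i) D′ D′<1+i (length-D′ y≤D)

  module _ (j<j′ : j Fin.< j′) where

    Ballot-ʳ++ : ∀ {c d} row v → Linked Fin._≤_ row →
      Ballot c d (row ʳ++ v) ⇔ (count j′ row + c ≤ d × Ballot (count j′ row + c) (count j row + d) v)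
    Ballot-ʳ++ []          v _      = mk⇔ (λ b → Ballot-head v b , b) proj₂
    Ballot-ʳ++ (a ∷ row) v sorted = step (Ballot-ʳ++ row (a ∷ v) (Linked.tail sorted))
      where
      no-j-after-j′ : a ≡ j′ → count j row ≡ 0
      no-j-after-j′ refl =
        count-none j (All.map (λ { j′≤z refl → <⇒≱ j<j′ j′≤z }) (All.tail (sorted⇒head≤ sorted)))
      absorb : ∀ {c d e} {B : Set} → d ≤ e → (c ≤ d × c ≤ e × B) ⇔ (c ≤ d × B)
      absorb d≤e = mk⇔ (λ (c≤d , _ , b) → c≤d , b) (λ (c≤d , b) → c≤d , ≤-trans c≤d d≤e , b)
      -- IH is an argument so that the case split on a also computes the counts in its type.
      step : ∀ {c d} →
        Ballot c d (row ʳ++ (a ∷ v))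
          ⇔ (count j′ row + c ≤ d × Ballot (count j′ row + c) (count j row + d) (a ∷ v)) →
        Ballot c d (row ʳ++ (a ∷ v))
          ⇔ (count j′ (a ∷ row) + c ≤ d × Ballot (count j′ (a ∷ row) + c) (count j (a ∷ row) + d) v)
      step {c} {d} IH with a Fin.≟ j′ | a Fin.≟ j
      ... | yes refl | yes a≡j = ⊥-elim (<-irrefl (cong toℕ (sym a≡j)) j<j′)
      ... | yes a≡j′ | no _    = mk⇔
        (λ b → let _ , _ , b′ = to IH b in subst (suc c′ ≤_) j-free (Ballot-head v b′) , b′)
        (λ (c′<d , b′) → from IH (<⇒≤ c′<d , <⇒≤ (subst (c′ <_) (sym j-free) c′<d) , b′))
        where
        c′ : ℕ
        c′ = count j′ row + c
        j-free : count j row + d ≡ d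
        j-free = cong (_+ d) (no-j-after-j′ a≡j′)
      ... | no _ | yes _ = absorb (m≤n+m d (count j row)) ⇔-∘ IH
      ... | no _ | no _  = absorb (m≤n+m d (count j row)) ⇔-∘ IH

    Ballot⇔RowBallot : ∀ {c d} T → All (Linked Fin._≤_) T → Ballot c d (readingWord T) ⇔ RowBallot c d T
    Ballot⇔RowBallot []           []                = ⇔-id _
    Ballot⇔RowBallot {c} {d} (row ∷ rows) (sorted ∷ sorteds) =
      (⇔-id _ ×-⇔ Ballot⇔RowBallot rows sorteds)
        ⇔-∘ subst (λ w → Ballot c d w ⇔ AfterRow) (ʳ++-defn row)
                  (Ballot-ʳ++ row (readingWord rows) sorted)
      where
      AfterRow : Set
      AfterRow = count j′ row + c ≤ d × Ballot (count j′ row + c) (count j row + d) (readingWord rows)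

    ColStrict⇔Yamanouchi-pair : ∀ T i → All (Linked Fin._≤_) T →
      ColStrict (rowsOf j T i) (rowsOf j′ T i)
        ⇔ (∀ n → count j′ (take n (readingWord T)) ≤ count j (take n (readingWord T)))
    ColStrict⇔Yamanouchi-pair T i sorted =
      Ballot⇔prefixes 0 0 (readingWord T)
        ⇔-∘ (⇔-sym (Ballot⇔RowBallot T sorted) ⇔-∘ ColStrict-rowsOf⇔RowBallot T i [] [] refl)

SigmaIs : ∀ {m} → (Fin m → ℕ) → Tab m → Permutation′ m → Set
SigmaIs la T π = ∀ r → sigma la T r ≡ + suc (toℕ (π ⟨$⟩ʳ r))

module Shape {m} (la : Fin m → ℕ) (T : Tab m) (π : Permutation′ m) (σ≡π : SigmaIs la T π) where

  τ : Fin m → ℕ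
  τ = shapeY la T

  Y-rowsOf : ∀ s → Y la T s ≡ rowsOf (π ⟨$⟩ˡ s) T 1
  Y-rowsOf = Yfrom-rowsOf π σ≡π 1 T

  shape-equation : ∀ s → τ s + suc (toℕ (π ⟨$⟩ˡ s)) ≡ suc (toℕ s) + la (π ⟨$⟩ˡ s)
  shape-equation s = begin
    τ s + suc (toℕ r)            ≡⟨ cong (_+ suc (toℕ r)) τ≡content ⟩
    content T r + suc (toℕ r)    ≡⟨ diff-+≡⇒+≡+ (content T r) (la r) (suc (toℕ r)) _ (σ≡π r) ⟩
    suc (toℕ (π ⟨$⟩ʳ r)) + la r  ≡⟨ cong (λ q → suc (toℕ q) + la r) (inverseʳ π) ⟩
    suc (toℕ s) + la r           ∎
    where
    open ≡-Reasoning
    r : Fin m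
    r = π ⟨$⟩ˡ s
    τ≡content : τ s ≡ content T r
    τ≡content = trans (cong length (Y-rowsOf s)) (length-rowsOf r T 1)

  shape-shift : ∀ s → + τ s ℤ.- + suc (toℕ s) ≡ + la (π ⟨$⟩ˡ s) ℤ.- + suc (toℕ (π ⟨$⟩ˡ s))
  shape-shift s = +≡+⇒diff≡diff (τ s) (suc (toℕ s)) (la r) (suc (toℕ r))
    (trans (shape-equation s) (+-comm (suc (toℕ s)) (la r)))
    where
    r : Fin m
    r = π ⟨$⟩ˡ s

  inverse-id : (∀ r → π ⟨$⟩ʳ r ≡ r) → ∀ s → π ⟨$⟩ˡ s ≡ s
  inverse-id π≡id s = trans (cong (π ⟨$⟩ˡ_) (sym (π≡id s))) (inverseˡ π)

  consec-comparable : ∀ {i j} → Consec i j →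
    π ⟨$⟩ˡ i Fin.< π ⟨$⟩ˡ j ⊎ π ⟨$⟩ˡ j Fin.< π ⟨$⟩ˡ i
  consec-comparable {i} {j} c with FinP.<-cmp (π ⟨$⟩ˡ i) (π ⟨$⟩ˡ j)
  ... | tri< lt _ _ = inj₁ lt
  ... | tri> _ _ gt = inj₂ gt
  ... | tri≈ _ eq _ = ⊥-elim (<-irrefl (cong toℕ i≡j) (Consec⇒< c))
    where
    i≡j : i ≡ j
    i≡j = trans (sym (inverseʳ π)) (trans (cong (π ⟨$⟩ʳ_) eq) (inverseʳ π))

  consec-shift : ∀ {i j} → Consec i j → τ i + suc (toℕ j) ≡ suc (τ i) + suc (toℕ i)
  consec-shift {i} c = trans (cong (λ k → τ i + suc k) c) (+-suc (τ i) (suc (toℕ i)))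

  module _ (wd : WeaklyDecreasing la) where

    ascent : ∀ {s s′} → π ⟨$⟩ˡ s Fin.< π ⟨$⟩ˡ s′ → τ s′ + suc (toℕ s) < τ s + suc (toℕ s′)
    ascent a<b = ascent-arith a<b (antitone wd (<⇒≤ a<b)) (shape-equation _) (shape-equation _)

    descent⇒jump : ∀ {i j} → Consec i j → π ⟨$⟩ˡ j Fin.< π ⟨$⟩ˡ i → suc (τ i) < τ j
    descent⇒jump {i} {j} c b<a = +-cancelʳ-< (suc (toℕ i)) (suc (τ i)) (τ j)
      (subst (_< τ j + suc (toℕ i)) (consec-shift c) (ascent b<a))

    ascent⇒drop : ∀ {i j} → Consec i j → π ⟨$⟩ˡ i Fin.< π ⟨$⟩ˡ j → τ j ≤ τ i
    ascent⇒drop {i} {j} c a<b = ℕ.s≤s⁻¹ (+-cancelʳ-< (suc (toℕ i)) (τ j) (suc (τ i))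
      (subst (τ j + suc (toℕ i) <_) (consec-shift c) (ascent a<b)))

    rise⇒descent : ∀ {i j} → Consec i j → τ i < τ j → π ⟨$⟩ˡ j Fin.< π ⟨$⟩ˡ i
    rise⇒descent c τi<τj with consec-comparable c
    ... | inj₁ a<b = ⊥-elim (<⇒≱ τi<τj (ascent⇒drop c a<b))
    ... | inj₂ b<a = b<a

    descent⇔jump : ∀ i j → Consec i j → (π ⟨$⟩ˡ j Fin.< π ⟨$⟩ˡ i) ⇔ (suc (τ i) < τ j)
    descent⇔jump i j c = mk⇔ (descent⇒jump c) (λ jump → rise⇒descent c (<-trans (n<1+n (τ i)) jump))

    rise⇒jump : ∀ i j → Consec i j → τ i < τ j → suc (τ i) < τ j
    rise⇒jump i j c = descent⇒jump c ∘ rise⇒descent c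

    weaklyDecreasing⇔id : WeaklyDecreasing τ ⇔ (∀ r → π ⟨$⟩ʳ r ≡ r)
    weaklyDecreasing⇔id = mk⇔ decreasing⇒id id⇒decreasing
      where
      decreasing⇒id : WeaklyDecreasing τ → ∀ r → π ⟨$⟩ʳ r ≡ r
      decreasing⇒id τ-dec r =
        trans (cong (π ⟨$⟩ʳ_) (sym (increasing⇒id (π ⟨$⟩ˡ_) increasing r))) (inverseʳ π)
        where
        increasing : ∀ i j → Consec i j → π ⟨$⟩ˡ i Fin.< π ⟨$⟩ˡ j
        increasing i j c with consec-comparable c
        ... | inj₁ a<b = a<b
        ... | inj₂ b<a = ⊥-elim (<⇒≱ (descent⇒jump c b<a) (≤-trans (τ-dec i j c) (n≤1+n (τ i))))
      id⇒decreasing : (∀ r → π ⟨$⟩ʳ r ≡ r) → WeaklyDecreasing τ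
      id⇒decreasing π≡id i j c = subst₂ _≤_ (sym (τ≡la j)) (sym (τ≡la i)) (wd i j c)
        where
        τ≡la : ∀ s → τ s ≡ la s
        τ≡la s = +-cancelʳ-≡ (suc (toℕ s)) (τ s) (la s) (trans
          (subst (λ q → τ s + suc (toℕ q) ≡ suc (toℕ s) + la q) (inverse-id π≡id s) (shape-equation s))
          (+-comm (suc (toℕ s)) (la s)))

    SSYT⇔Yamanouchi : All (Linked Fin._≤_) T → (∀ r → π ⟨$⟩ʳ r ≡ r) →
      IsSSYT (Y la T) ⇔ Yamanouchi (readingWord T)
    SSYT⇔Yamanouchi sorted π≡id = mk⇔
      (λ (_ , _ , strict) n j j′ c → to (columns j j′ c) (strict j j′ c) n)
      (λ yam → from weaklyDecreasing⇔id π≡id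
             , (λ s → subst (Linked _≤_) (sym (Y≡rowsOf s)) (rowsOf-sorted s T 1))
             , (λ j j′ c → from (columns j j′ c) (λ n → yam n j j′ c)))
      where
      Y≡rowsOf : ∀ s → Y la T s ≡ rowsOf s T 1
      Y≡rowsOf s = trans (Y-rowsOf s) (cong (λ a → rowsOf a T 1) (inverse-id π≡id s))
      columns : ∀ j j′ → Consec j j′ → ColStrict (Y la T j) (Y la T j′)
        ⇔ (∀ n → count j′ (take n (readingWord T)) ≤ count j (take n (readingWord T)))
      columns j j′ c rewrite Y≡rowsOf j | Y≡rowsOf j′ =
        ColStrict⇔Yamanouchi-pair j j′ (Consec⇒< c) T 1 sorted

shape-determines-inverse : ∀ {m} {la : Fin m → ℕ} → WeaklyDecreasing la →
  ∀ {T T′ π π′} → SigmaIs la T π → SigmaIs la T′ π′ →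
  (∀ s → shapeY la T s ≡ shapeY la T′ s) → ∀ s → π ⟨$⟩ˡ s ≡ π′ ⟨$⟩ˡ s
shape-determines-inverse {la = la} wd {T} {T′} {π} {π′} σ≡π σ′≡π′ τ≡τ′ s =
  la-minus-id-injective wd (Shape.shape-equation la T π σ≡π s)
    (subst (λ t → t + suc (toℕ (π′ ⟨$⟩ˡ s)) ≡ suc (toℕ s) + la (π′ ⟨$⟩ˡ s)) (sym (τ≡τ′ s))
      (Shape.shape-equation la T′ π′ σ′≡π′ s))

Y-injective : ∀ {m} {la : Fin m → ℕ} → WeaklyDecreasing la → ∀ {k} {T T′ : Tab m} →
  SkewRows k T → SkewRows k T′ → ∃ (SigmaIs la T) → ∃ (SigmaIs la T′) →
  (∀ s → Y la T s ≡ Y la T′ s) → T ≡ T′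
Y-injective {m} {la} wd {k} {T} {T′} skew skew′ (π , σ≡π) (π′ , σ′≡π′) Y≡Y′ =
  rowsOf-injective k 1 T T′ skew skew′ rowsOf≡rowsOf′
  where
  π⁻¹≡π′⁻¹ : ∀ s → π ⟨$⟩ˡ s ≡ π′ ⟨$⟩ˡ s
  π⁻¹≡π′⁻¹ = shape-determines-inverse {la = la} wd {T} {T′} {π} {π′} σ≡π σ′≡π′
    (λ s → cong length (Y≡Y′ s))
  rowsOf≡rowsOf′ : ∀ a → rowsOf a T 1 ≡ rowsOf a T′ 1
  rowsOf≡rowsOf′ a = begin
    rowsOf a T 1             ≡⟨ cong (λ b → rowsOf b T 1) (inverseˡ π) ⟨
    rowsOf (π ⟨$⟩ˡ s) T 1    ≡⟨ Shape.Y-rowsOf la T π σ≡π s ⟨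
    Y la T s                 ≡⟨ Y≡Y′ s ⟩
    Y la T′ s                ≡⟨ Shape.Y-rowsOf la T′ π′ σ′≡π′ s ⟩
    rowsOf (π′ ⟨$⟩ˡ s) T′ 1  ≡⟨ cong (λ b → rowsOf b T′ 1) (trans (sym (π⁻¹≡π′⁻¹ s)) (inverseˡ π)) ⟩
    rowsOf a T′ 1            ∎
    where
    open ≡-Reasoning
    s : Fin m
    s = π ⟨$⟩ʳ a

lemma7p16 : (m : ℕ) (la : Fin m → ℕ) → WeaklyDecreasing la →
    (α : List ℕ) → All (1 ≤_) α →
    ((T : Tab m) (π : Permutation′ m) → IsSkewImmaculate α T →
      (∀ r → sigma la T r ≡ + suc (toℕ (π ⟨$⟩ʳ r))) →
        (∀ s → (+ shapeY la T s) ℤ.- (+ suc (toℕ s))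
               ≡ (+ la (π ⟨$⟩ˡ s)) ℤ.- (+ suc (toℕ (π ⟨$⟩ˡ s))))
        × (∀ i j → Consec i j →
             ((π ⟨$⟩ˡ j) Fin.< (π ⟨$⟩ˡ i)) ⇔ (suc (shapeY la T i) < shapeY la T j))
        × (∀ i j → Consec i j → shapeY la T i < shapeY la T j →
             suc (shapeY la T i) < shapeY la T j)
        × (WeaklyDecreasing (shapeY la T) ⇔ (∀ r → π ⟨$⟩ʳ r ≡ r))
        × ((∀ r → π ⟨$⟩ʳ r ≡ r) →
             (IsSSYT (Y la T) ⇔ Yamanouchi (readingWord T))))
    × ((T T′ : Tab m) →
        IsSkewImmaculate α T → ∃ (λ (π : Permutation′ m) → ∀ r → sigma la T r ≡ + suc (toℕ (π ⟨$⟩ʳ r))) →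
        IsSkewImmaculate α T′ → ∃ (λ (π : Permutation′ m) → ∀ r → sigma la T′ r ≡ + suc (toℕ (π ⟨$⟩ʳ r))) →
        (∀ s → Y la T s ≡ Y la T′ s) → T ≡ T′)
lemma7p16 m la wd α _ =
  (λ T π (_ , sorted , _) σ≡π → let open Shape la T π σ≡π in
     shape-shift , descent⇔jump wd , rise⇒jump wd , weaklyDecreasing⇔id wd , SSYT⇔Yamanouchi wd sorted)
  , λ T T′ skew σ skew′ σ′ →
      Y-injective {la = la} wd (IsSkewImmaculate⇒SkewRows α skew) (IsSkewImmaculate⇒SkewRows α skew′) σ σ′
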